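{- (Euler's Formula for Resistance Function II.) Let $\Gamma$ be a metrized graph with edge set $E(\Gamma)$, where each edge $e_i$ has end points $p_i,q_i$ and length $L_i$. For any $s,t\in V(\Gamma)$, $$r(s,t)=\frac14\sum_{e_i\in E(\Gamma)}\frac{1}{L_i}\Big[r(p_i,s)-r(q_i,s)-r(p_i,t)+r(q_i,t)\Big]^2 .$$
   Context: A metrized graph $\Gamma$ is a finite connected graph (multiple edges and self-loops allowed) in which each edge is identified with a closed line segment of positive length, given with a finite nonempty vertex set $V(\Gamma)$ containing all points of valence $\neq 2$; its edge set $E(\Gamma)$ consists of the closed segments between vertices. It is regarded as a resistive electrical network in which each edge is a resistor whose resistance equals its length; $r(x,y)$ denotes the effective resistance between $x,y\in\Gamma$. -}

module Defs where

open import Level using (Level; _⊔_) renaming (suc to lsuc)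
open import Data.Nat using (ℕ; zero; suc)
open import Data.Fin using (Fin; _≟_)
import Data.Fin as Fin
open import Data.Bool using (if_then_else_)
open import Data.Product using (Σ; _×_)
open import Relation.Nullary using (¬_)
open import Relation.Nullary.Decidable using (⌊_⌋)
open import Relation.Binary using (Rel; IsStrictTotalOrder)
open import Algebra.Bundles using (CommutativeRing)

-- An ordered field (the real numbers ℝ being the intended instance).
-- The inverse is total; it is only constrained on nonzero elements.
record OrderedField (c ℓ₁ ℓ₂ : Level) : Set (lsuc (c ⊔ ℓ₁ ⊔ ℓ₂)) where
  field
    commutativeRing : CommutativeRing c ℓ₁
  open CommutativeRing commutativeRing public
  field
    _<_                 : Rel Carrier ℓ₂
    <-isStrictTotalOrder : IsStrictTotalOrder _≈_ _<_
    +-monoˡ-<           : ∀ {x y} z → x < y → (x + z) < (y + z)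
    *-pos               : ∀ {x y} → 0# < x → 0# < y → 0# < (x * y)
    0<1                 : 0# < 1#
    _⁻¹                 : Carrier → Carrier
    ⁻¹-inverse          : ∀ {x} → ¬ (x ≈ 0#) → (x * (x ⁻¹)) ≈ 1#

module _ {c ℓ₁ ℓ₂ : Level} (F : OrderedField c ℓ₁ ℓ₂) where
  open OrderedField F hiding (zero)

  sumF : (m : ℕ) → (Fin m → Carrier) → Carrier
  sumF zero    f = 0#
  sumF (suc m) f = f Fin.zero + sumF m (λ i → f (Fin.suc i))

  ind : {n : ℕ} → Fin n → Fin n → Carrier
  ind x y = if ⌊ x ≟ y ⌋ then 1# else 0#

  sq : Carrier → Carrier
  sq x = x * x

  -- A metrized graph, given by its vertex set V = Fin nV and edge set
  -- E = Fin nE; edge e has end points p e, q e and length L e > 0.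
  -- Multiple edges and self-loops are allowed.
  record MetrizedGraph : Set (c ⊔ ℓ₂) where
    field
      nV nE     : ℕ
      vertex₀   : Fin nV
      p q       : Fin nE → Fin nV
      L         : Fin nE → Carrier
      L-pos     : ∀ e → 0# < L e

  open MetrizedGraph

  data Reach (Γ : MetrizedGraph) : Fin (nV Γ) → Fin (nV Γ) → Set where
    here : ∀ {x} → Reach Γ x x
    fwd  : ∀ {y} e → Reach Γ (q Γ e) y → Reach Γ (p Γ e) y
    bwd  : ∀ {y} e → Reach Γ (p Γ e) y → Reach Γ (q Γ e) y

  Connected : MetrizedGraph → Set
  Connected Γ = ∀ x y → Reach Γ x y

  -- Net current flowing out of vertex x into the edges, for the potential v,
  -- where the current through edge e from p e to q e is (v(p e) - v(q e)) / L e.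
  outflow : (Γ : MetrizedGraph) → (Fin (nV Γ) → Carrier) → Fin (nV Γ) → Carrier
  outflow Γ v x = sumF (nE Γ) (λ e →
      (L Γ e ⁻¹) * ((ind x (p Γ e) * (v (p Γ e) - v (q Γ e)))
                   + (ind x (q Γ e) * (v (q Γ e) - v (p Γ e)))))

  -- v is a voltage potential when a unit current enters at a and exits at b
  -- (Kirchhoff's current law + Ohm's law).
  IsUnitPotential : (Γ : MetrizedGraph) → Fin (nV Γ) → Fin (nV Γ)
                  → (Fin (nV Γ) → Carrier) → Set ℓ₁
  IsUnitPotential Γ a b v = ∀ x → outflow Γ v x ≈ (ind x a - ind x b)

  IsResistance : (Γ : MetrizedGraph) → Fin (nV Γ) → Fin (nV Γ) → Carrier → Set (c ⊔ ℓ₁)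
  IsResistance Γ a b ρ =
    Σ (Fin (nV Γ) → Carrier) λ v → IsUnitPotential Γ a b v × (ρ ≈ (v a - v b))

  four : Carrier
  four = 1# + 1# + 1# + 1#

-- The discrete Green identity  Σₓ f(x)·(outflow of g at x) = Σₑ (f(pₑ) − f(qₑ))(g(pₑ) − g(qₑ)) / Lₑ
-- shows that a unit potential φ from a to b pairs with any f as f(a) − f(b).  Hence
-- r(s,t) is the energy Σₑ (v(pₑ) − v(qₑ))² / Lₑ of the unit potential v from s to t, and
-- the same pairing yields reciprocity φ_ab(c) − φ_ab(d) = φ_cd(a) − φ_cd(b).  Reciprocity
-- writes every potential difference, in particular every r(x,y), in terms of the symmetric
-- Green's function grounded at t, and in those terms
-- r(pₑ,s) − r(qₑ,s) − r(pₑ,t) + r(qₑ,t) = −2 (v(pₑ) − v(qₑ)); squaring and summing over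
-- the edges gives four times the energy.
module Submission where

open import Defs
open import Level using (Level)
open import Data.Nat using (ℕ; zero; suc)
import Data.Maybe as Maybe
open import Data.Fin using (Fin; zero; suc; _≟_)
open import Data.Product using (proj₁; proj₂)
open import Function using (_∘_)
open import Relation.Nullary using (¬_; yes; no)
open import Relation.Nullary.Decidable using (dec⇒maybe)
open import Relation.Binary using (IsStrictTotalOrder)
open import Relation.Binary.PropositionalEquality as ≡ using (_≡_)
open import Algebra.Bundles using (CommutativeRing)
open import Algebra.Solver.Ring.AlmostCommutativeRing
  using (_-Raw-AlmostCommutative⟶_; fromCommutativeRing)

module IntegerCoefficientSolver {c ℓ} (R : CommutativeRing c ℓ) where
  open CommutativeRing R
  import Data.Nat as ℕ
  import Data.Nat.Properties as ℕ
  open import Data.Integer as ℤ using (ℤ; +_; -[1+_])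
  import Data.Integer.Properties as ℤ
  open import Data.Sign as Sign using (Sign)
  open import Algebra.Properties.Ring ring using (-‿involutive; -0#≈0#; -‿distribˡ-*)
  open import Algebra.Properties.AbelianGroup +-abelianGroup using (⁻¹-∙-comm)
  open import Algebra.Properties.CommutativeSemigroup +-commutativeSemigroup
    using () renaming (interchange to +-interchange)
  open import Algebra.Properties.CommutativeSemigroup *-commutativeSemigroup
    using () renaming (interchange to *-interchange)
  open import Algebra.Properties.Semiring.Mult.TCOptimised semiring
    using (_×_; ×-homo-+; ×1-homo-*)
  open import Relation.Binary.Reasoning.Setoid setoid

  -- With the type-checking-optimised _×_, ⟦ + 4 ⟧ℤ is literally 1# + 1# + 1# + 1#.
  ⟦_⟧ℤ : ℤ → Carrier
  ⟦ + n ⟧ℤ      = n × 1#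
  ⟦ -[1+ n ] ⟧ℤ = - (suc n × 1#)

  private
    suc-homo : ∀ n → suc n × 1# ≈ 1# + n × 1#
    suc-homo = ×-homo-+ 1# 1

    [1+a]-[1+b]≈a-b : ∀ a b → (1# + a) - (1# + b) ≈ a - b
    [1+a]-[1+b]≈a-b a b = begin
      (1# + a) + - (1# + b)     ≈⟨ +-congˡ (⁻¹-∙-comm 1# b) ⟨
      (1# + a) + (- 1# + - b)   ≈⟨ +-interchange 1# a (- 1#) (- b) ⟩
      (1# - 1#) + (a - b)       ≈⟨ +-congʳ (-‿inverseʳ 1#) ⟩
      0# + (a - b)              ≈⟨ +-identityˡ _ ⟩
      a - b                     ∎

    ⊖-homo : ∀ m n → ⟦ m ℤ.⊖ n ⟧ℤ ≈ m × 1# - n × 1#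
    ⊖-homo m       zero    = sym (trans (+-congˡ -0#≈0#) (+-identityʳ _))
    ⊖-homo zero    (suc n) = sym (+-identityˡ _)
    ⊖-homo (suc m) (suc n) = begin
      ⟦ suc m ℤ.⊖ suc n ⟧ℤ              ≡⟨ ≡.cong ⟦_⟧ℤ (ℤ.[1+m]⊖[1+n]≡m⊖n m n) ⟩
      ⟦ m ℤ.⊖ n ⟧ℤ                      ≈⟨ ⊖-homo m n ⟩
      m × 1# - n × 1#                   ≈⟨ [1+a]-[1+b]≈a-b _ _ ⟨
      (1# + m × 1#) - (1# + n × 1#)     ≈⟨ +-cong (suc-homo m) (-‿cong (suc-homo n)) ⟨
      suc m × 1# - suc n × 1#           ∎

    +-homo : ∀ i j → ⟦ i ℤ.+ j ⟧ℤ ≈ ⟦ i ⟧ℤ + ⟦ j ⟧ℤ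
    +-homo (+ m)    (+ n)    = ×-homo-+ 1# m n
    +-homo (+ m)    -[1+ n ] = ⊖-homo m (suc n)
    +-homo -[1+ m ] (+ n)    = trans (⊖-homo n (suc m)) (+-comm _ _)
    +-homo -[1+ m ] -[1+ n ] = begin
      - (suc (suc (m ℕ.+ n)) × 1#)      ≡⟨ ≡.cong (λ k → - (suc k × 1#)) (ℕ.+-suc m n) ⟨
      - ((suc m ℕ.+ suc n) × 1#)        ≈⟨ -‿cong (×-homo-+ 1# (suc m) (suc n)) ⟩
      - (suc m × 1# + suc n × 1#)       ≈⟨ ⁻¹-∙-comm _ _ ⟨
      - (suc m × 1#) + - (suc n × 1#)   ∎

    sgn : Sign → Carrier
    sgn Sign.+ = 1#
    sgn Sign.- = - 1#

    -x≈-1*x : ∀ x → - x ≈ - 1# * x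
    -x≈-1*x x = trans (-‿cong (sym (*-identityˡ x))) (-‿distribˡ-* 1# x)

    ◃-homo : ∀ s n → ⟦ s ℤ.◃ n ⟧ℤ ≈ sgn s * n × 1#
    ◃-homo Sign.+ zero    = sym (zeroʳ _)
    ◃-homo Sign.- zero    = sym (zeroʳ _)
    ◃-homo Sign.+ (suc n) = sym (*-identityˡ _)
    ◃-homo Sign.- (suc n) = -x≈-1*x _

    sign-abs-homo : ∀ i → ⟦ i ⟧ℤ ≈ sgn (ℤ.sign i) * ℤ.∣ i ∣ × 1#
    sign-abs-homo (+ n)    = sym (*-identityˡ _)
    sign-abs-homo -[1+ n ] = -x≈-1*x _

    sgn-homo : ∀ s t → sgn (s Sign.* t) ≈ sgn s * sgn t
    sgn-homo Sign.+ Sign.+ = sym (*-identityˡ _)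
    sgn-homo Sign.+ Sign.- = sym (*-identityˡ _)
    sgn-homo Sign.- Sign.+ = sym (*-identityʳ _)
    sgn-homo Sign.- Sign.- = trans (sym (-‿involutive 1#)) (-x≈-1*x (- 1#))

    *-homo : ∀ i j → ⟦ i ℤ.* j ⟧ℤ ≈ ⟦ i ⟧ℤ * ⟦ j ⟧ℤ
    *-homo i j = begin
      ⟦ i ℤ.* j ⟧ℤ
        ≈⟨ ◃-homo (ℤ.sign i Sign.* ℤ.sign j) (ℤ.∣ i ∣ ℕ.* ℤ.∣ j ∣) ⟩
      sgn (ℤ.sign i Sign.* ℤ.sign j) * (ℤ.∣ i ∣ ℕ.* ℤ.∣ j ∣) × 1#
        ≈⟨ *-cong (sgn-homo (ℤ.sign i) (ℤ.sign j)) (×1-homo-* ℤ.∣ i ∣ ℤ.∣ j ∣) ⟩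
      (sgn (ℤ.sign i) * sgn (ℤ.sign j)) * (ℤ.∣ i ∣ × 1# * ℤ.∣ j ∣ × 1#)
        ≈⟨ *-interchange _ _ _ _ ⟩
      (sgn (ℤ.sign i) * ℤ.∣ i ∣ × 1#) * (sgn (ℤ.sign j) * ℤ.∣ j ∣ × 1#)
        ≈⟨ *-cong (sign-abs-homo i) (sign-abs-homo j) ⟨
      ⟦ i ⟧ℤ * ⟦ j ⟧ℤ
        ∎

    neg-homo : ∀ i → ⟦ ℤ.- i ⟧ℤ ≈ - ⟦ i ⟧ℤ
    neg-homo -[1+ n ]    = sym (-‿involutive _)
    neg-homo (+ zero)    = sym -0#≈0#
    neg-homo (+ (suc n)) = refl

  ℤ⟶R : ℤ.+-*-rawRing -Raw-AlmostCommutative⟶ fromCommutativeRing R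
  ℤ⟶R = record
    { ⟦_⟧    = ⟦_⟧ℤ
    ; +-homo = +-homo
    ; *-homo = *-homo
    ; -‿homo = neg-homo
    ; 0-homo = refl
    ; 1-homo = refl
    }

  open import Algebra.Solver.Ring ℤ.+-*-rawRing (fromCommutativeRing R) ℤ⟶R
    (λ i j → Maybe.map (reflexive ∘ ≡.cong ⟦_⟧ℤ) (dec⇒maybe (i ℤ.≟ j)))
    public

module ElectricalNetwork {c ℓ₁ ℓ₂} (F : OrderedField c ℓ₁ ℓ₂) where
  open OrderedField F hiding (zero)
  open IntegerCoefficientSolver commutativeRing using (solve; _:=_; _:+_; _:-_; _:*_; :-_; con)
  import Data.Integer as ℤ
  open import Algebra.Properties.Semiring.Sum semiring
    using (sum; sum-cong-≋; ∑-distrib-+; ∑-comm; *-distribˡ-sum; *-distribʳ-sum)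
  open import Relation.Binary.Reasoning.Setoid setoid

  private module < = IsStrictTotalOrder <-isStrictTotalOrder

  0<x⇒0<x+1 : ∀ {x} → 0# < x → 0# < (x + 1#)
  0<x⇒0<x+1 0<x = <.trans (<.<-respʳ-≈ (sym (+-identityˡ 1#)) 0<1) (+-monoˡ-< 1# 0<x)

  four≉0 : ¬ four F ≈ 0#
  four≉0 four≈0 = <.irrefl (sym four≈0) (0<x⇒0<x+1 (0<x⇒0<x+1 (0<x⇒0<x+1 0<1)))

  four⁻¹*four*x≈x : ∀ x → four F ⁻¹ * (four F * x) ≈ x
  four⁻¹*four*x≈x x = begin
    four F ⁻¹ * (four F * x)   ≈⟨ *-assoc _ _ _ ⟨
    four F ⁻¹ * four F * x     ≈⟨ *-congʳ (trans (*-comm _ _) (⁻¹-inverse four≉0)) ⟩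
    1# * x                     ≈⟨ *-identityˡ x ⟩
    x                          ∎

  minus-cong : ∀ {u u′ v v′} → u ≈ u′ → v ≈ v′ → u - v ≈ u′ - v′
  minus-cong u≈u′ v≈v′ = +-cong u≈u′ (-‿cong v≈v′)

  sq-cong : ∀ {u v} → u ≈ v → sq F u ≈ sq F v
  sq-cong u≈v = *-cong u≈v u≈v

  sq-neg-double : ∀ x → sq F (- (x + x)) ≈ four F * sq F x
  sq-neg-double =
    solve 1 (λ x → (:- (x :+ x)) :* (:- (x :+ x)) := con (ℤ.+ 4) :* (x :* x)) refl

  sumF≡sum : ∀ m (f : Fin m → Carrier) → sumF F m f ≡ sum f
  sumF≡sum zero    f = ≡.refl
  sumF≡sum (suc m) f = ≡.cong (f zero +_) (sumF≡sum m (f ∘ suc))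

  ind-suc : ∀ {n} (x a : Fin n) → ind F (suc x) (suc a) ≡ ind F x a
  ind-suc x a with x ≟ a
  ... | yes _ = ≡.refl
  ... | no _  = ≡.refl

  sum-*-ind : ∀ {n} (f : Fin n → Carrier) a → sum (λ x → f x * ind F x a) ≈ f a
  sum-*-ind f zero = begin
    f zero * 1# + sum (λ x → f (suc x) * 0#)
      ≈⟨ +-cong (*-identityʳ _) (sym (*-distribʳ-sum 0# (f ∘ suc))) ⟩
    f zero + sum (f ∘ suc) * 0#                ≈⟨ +-congˡ (zeroʳ _) ⟩
    f zero + 0#                                ≈⟨ +-identityʳ _ ⟩
    f zero                                     ∎
  sum-*-ind f (suc a) = begin
    f zero * 0# + sum (λ x → f (suc x) * ind F (suc x) (suc a))
      ≈⟨ +-congˡ (sum-cong-≋ (λ x → *-congˡ (reflexive (ind-suc x a)))) ⟩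
    f zero * 0# + sum (λ x → f (suc x) * ind F x a)
      ≈⟨ +-cong (zeroʳ _) (sum-*-ind (f ∘ suc) a) ⟩
    0# + f (suc a)
      ≈⟨ +-identityˡ _ ⟩
    f (suc a)
      ∎

  sum-*-unitSource : ∀ {n} (f : Fin n → Carrier) a b →
                     sum (λ x → f x * (ind F x a - ind F x b)) ≈ f a - f b
  sum-*-unitSource f a b = begin
    sum (λ x → f x * (ind F x a - ind F x b))
      ≈⟨ sum-cong-≋ (λ x → split (f x) (ind F x a) (ind F x b)) ⟩
    sum (λ x → f x * ind F x a + (- f x) * ind F x b)
      ≈⟨ ∑-distrib-+ (λ x → f x * ind F x a) (λ x → (- f x) * ind F x b) ⟩
    sum (λ x → f x * ind F x a) + sum (λ x → (- f x) * ind F x b)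
      ≈⟨ +-cong (sum-*-ind f a) (sum-*-ind (-_ ∘ f) b) ⟩
    f a - f b
      ∎
    where
    split : ∀ u x y → u * (x - y) ≈ u * x + (- u) * y
    split = solve 3 (λ u x y → u :* (x :- y) := u :* x :+ (:- u) :* y) refl

  module Network (Γ : MetrizedGraph F) where
    open MetrizedGraph Γ

    edgeOutflow : (Fin nV → Carrier) → Fin nV → Fin nE → Carrier
    edgeOutflow v x e = (L e ⁻¹) * ((ind F x (p e) * (v (p e) - v (q e)))
                                  + (ind F x (q e) * (v (q e) - v (p e))))

    energy : (Fin nV → Carrier) → (Fin nV → Carrier) → Carrier
    energy f g = sum (λ e → L e ⁻¹ * ((f (p e) - f (q e)) * (g (p e) - g (q e))))

    energy-sym : ∀ f g → energy f g ≈ energy g f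
    energy-sym f g = sum-cong-≋ {nE} (λ e → *-congˡ (*-comm _ _))

    sum-*-edgeOutflow : ∀ f g e → sum (λ x → f x * edgeOutflow g x e)
                                  ≈ L e ⁻¹ * ((f (p e) - f (q e)) * (g (p e) - g (q e)))
    sum-*-edgeOutflow f g e = begin
      sum (λ x → f x * edgeOutflow g x e)
        ≈⟨ sum-cong-≋ (λ x → split (f x) (L e ⁻¹) (ind F x (p e)) (ind F x (q e)) _ _) ⟩
      sum (λ x → f x * ind F x (p e) * A + f x * ind F x (q e) * B)
        ≈⟨ ∑-distrib-+ (λ x → f x * ind F x (p e) * A) (λ x → f x * ind F x (q e) * B) ⟩
      sum (λ x → f x * ind F x (p e) * A) + sum (λ x → f x * ind F x (q e) * B)
        ≈⟨ +-cong (*-distribʳ-sum A (λ x → f x * ind F x (p e)))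
                  (*-distribʳ-sum B (λ x → f x * ind F x (q e))) ⟨
      sum (λ x → f x * ind F x (p e)) * A + sum (λ x → f x * ind F x (q e)) * B
        ≈⟨ +-cong (*-congʳ (sum-*-ind f (p e))) (*-congʳ (sum-*-ind f (q e))) ⟩
      f (p e) * A + f (q e) * B
        ≈⟨ collect (L e ⁻¹) (f (p e)) (f (q e)) (g (p e)) (g (q e)) ⟩
      L e ⁻¹ * ((f (p e) - f (q e)) * (g (p e) - g (q e)))
        ∎
      where
      A = L e ⁻¹ * (g (p e) - g (q e))
      B = L e ⁻¹ * (g (q e) - g (p e))
      split : ∀ u l i j a b → u * (l * (i * (a - b) + j * (b - a)))
                              ≈ u * i * (l * (a - b)) + u * j * (l * (b - a))
      split = solve 6 (λ u l i j a b →
        u :* (l :* (i :* (a :- b) :+ j :* (b :- a)))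
          := u :* i :* (l :* (a :- b)) :+ u :* j :* (l :* (b :- a))) refl
      collect : ∀ l fp fq a b →
                fp * (l * (a - b)) + fq * (l * (b - a)) ≈ l * ((fp - fq) * (a - b))
      collect = solve 5 (λ l fp fq a b →
        fp :* (l :* (a :- b)) :+ fq :* (l :* (b :- a)) := l :* ((fp :- fq) :* (a :- b))) refl

    sum-*-outflow≈energy : ∀ f g → sum (λ x → f x * outflow F Γ g x) ≈ energy f g
    sum-*-outflow≈energy f g = begin
      sum (λ x → f x * outflow F Γ g x)
        ≈⟨ sum-cong-≋ (λ x → trans (*-congˡ (reflexive (sumF≡sum nE (edgeOutflow g x))))
                                    (*-distribˡ-sum (f x) (edgeOutflow g x))) ⟩
      sum (λ x → sum (λ e → f x * edgeOutflow g x e))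
        ≈⟨ ∑-comm (λ x e → f x * edgeOutflow g x e) ⟩
      sum (λ e → sum (λ x → f x * edgeOutflow g x e))
        ≈⟨ sum-cong-≋ (sum-*-edgeOutflow f g) ⟩
      energy f g
        ∎

    energy-unitPotential : ∀ {a b} φ → IsUnitPotential F Γ a b φ → ∀ f → energy f φ ≈ f a - f b
    energy-unitPotential {a} {b} φ φ-unit f = begin
      energy f φ                                   ≈⟨ sum-*-outflow≈energy f φ ⟨
      sum (λ x → f x * outflow F Γ φ x)            ≈⟨ sum-cong-≋ (λ x → *-congˡ (φ-unit x)) ⟩
      sum (λ x → f x * (ind F x a - ind F x b))    ≈⟨ sum-*-unitSource f a b ⟩
      f a - f b                                    ∎

    reciprocity : ∀ {a b c d} φ ψ → IsUnitPotential F Γ a b φ → IsUnitPotential F Γ c d ψ →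
                  φ c - φ d ≈ ψ a - ψ b
    reciprocity {a} {b} {c} {d} φ ψ φ-unit ψ-unit = begin
      φ c - φ d     ≈⟨ energy-unitPotential ψ ψ-unit φ ⟨
      energy φ ψ    ≈⟨ energy-sym φ ψ ⟩
      energy ψ φ    ≈⟨ energy-unitPotential φ φ-unit ψ ⟩
      ψ a - ψ b     ∎

    module EffectiveResistance (r : Fin nV → Fin nV → Carrier)
                               (r-resistance : ∀ x y → IsResistance F Γ x y (r x y)) where

      potential : Fin nV → Fin nV → Fin nV → Carrier
      potential a b = proj₁ (r-resistance a b)

      potential-unit : ∀ a b → IsUnitPotential F Γ a b (potential a b)
      potential-unit a b = proj₁ (proj₂ (r-resistance a b))

      resistance≈potential-difference : ∀ a b → r a b ≈ potential a b a - potential a b b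
      resistance≈potential-difference a b = proj₂ (proj₂ (r-resistance a b))

      resistance≈energy : ∀ a b → r a b ≈ energy (potential a b) (potential a b)
      resistance≈energy a b = begin
        r a b                                       ≈⟨ resistance≈potential-difference a b ⟩
        potential a b a - potential a b b
          ≈⟨ energy-unitPotential (potential a b) (potential-unit a b) (potential a b) ⟨
        energy (potential a b) (potential a b)
          ∎

      green-function : Fin nV → Fin nV → Fin nV → Carrier
      green-function o a x = potential a o x - potential a o o

      green-function-sym : ∀ o a x → green-function o a x ≈ green-function o x a
      green-function-sym o a x =
        reciprocity (potential a o) (potential x o) (potential-unit a o) (potential-unit x o)

      potential-difference≈green : ∀ o a b x y →
        let G = green-function o in
        potential a b x - potential a b y ≈ (G a x - G a y) - (G b x - G b y)
      potential-difference≈green o a b x y = begin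
        φ a b x - φ a b y
          ≈⟨ reciprocity′ a b x y ⟩
        φ x y a - φ x y b
          ≈⟨ via (φ x y o) ⟩
        (φ x y a - φ x y o) - (φ x y b - φ x y o)
          ≈⟨ minus-cong (reciprocity′ a o x y) (reciprocity′ b o x y) ⟨
        (φ a o x - φ a o y) - (φ b o x - φ b o y)
          ≈⟨ minus-cong (via (φ a o o)) (via (φ b o o)) ⟩
        (G a x - G a y) - (G b x - G b y)
          ∎
        where
        φ = potential
        G = green-function o
        reciprocity′ : ∀ a b c d → φ a b c - φ a b d ≈ φ c d a - φ c d b
        reciprocity′ a b c d =
          reciprocity (φ a b) (φ c d) (potential-unit a b) (potential-unit c d)
        via : ∀ {u v} w → u - v ≈ (u - w) - (v - w)
        via {u} {v} w = solve 3 (λ u v w → u :- v := (u :- w) :- (v :- w)) refl u v w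

      resistance≈green : ∀ o x y → let G = green-function o in
                         r x y ≈ (G x x - G y x) - (G y x - G y y)
      resistance≈green o x y = begin
        r x y
          ≈⟨ resistance≈potential-difference x y ⟩
        potential x y x - potential x y y
          ≈⟨ potential-difference≈green o x y x y ⟩
        (G x x - G x y) - (G y x - G y y)
          ≈⟨ minus-cong (minus-cong refl (green-function-sym o x y)) refl ⟩
        (G x x - G y x) - (G y x - G y y)
          ∎
        where G = green-function o

      resistance-cross-difference : ∀ s t x y → let δ = potential s t x - potential s t y in
                                    ((r x s - r y s) - r x t) + r y t ≈ - (δ + δ)
      resistance-cross-difference s t x y = begin
        ((r x s - r y s) - r x t) + r y t
          ≈⟨ +-cong (minus-cong (minus-cong (ρ≈ x s) (ρ≈ y s)) (ρ≈ x t)) (ρ≈ y t) ⟩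
        ((ρ x s - ρ y s) - ρ x t) + ρ y t
          ≈⟨ collect (G x x) (G y y) (G s s) (G t t) (G s x) (G s y) (G t x) (G t y) ⟩
        - (d + d)
          ≈⟨ -‿cong (+-cong δ≈d δ≈d) ⟨
        - (δ + δ)
          ∎
        where
        G = green-function t
        ρ : Fin nV → Fin nV → Carrier
        ρ a b = (G a a - G b a) - (G b a - G b b)
        ρ≈ = resistance≈green t
        δ = potential s t x - potential s t y
        d = (G s x - G s y) - (G t x - G t y)
        δ≈d = potential-difference≈green t s t x y
        collect : ∀ xx yy ss tt sx sy tx ty →
          ((((xx - sx) - (sx - ss)) - ((yy - sy) - (sy - ss))) - ((xx - tx) - (tx - tt)))
            + ((yy - ty) - (ty - tt))
          ≈ - (((sx - sy) - (tx - ty)) + ((sx - sy) - (tx - ty)))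
        collect = solve 8 (λ xx yy ss tt sx sy tx ty →
          ((((xx :- sx) :- (sx :- ss)) :- ((yy :- sy) :- (sy :- ss))) :- ((xx :- tx) :- (tx :- tt)))
            :+ ((yy :- ty) :- (ty :- tt))
          := :- (((sx :- sy) :- (tx :- ty)) :+ ((sx :- sy) :- (tx :- ty)))) refl

theorem3p9 : ∀ {c ℓ₁ ℓ₂ : Level} (F : OrderedField c ℓ₁ ℓ₂) (Γ : MetrizedGraph F)
  → Connected F Γ
  → (r : Fin (MetrizedGraph.nV Γ) → Fin (MetrizedGraph.nV Γ) → OrderedField.Carrier F)
  → (∀ x y → IsResistance F Γ x y (r x y))
  → ∀ s t →
    let open OrderedField F
        open MetrizedGraph Γ
    in r s t ≈ ((four F ⁻¹) * sumF F nE (λ i →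
         (L i ⁻¹) * sq F (((r (p i) s - r (q i) s) - r (p i) t) + r (q i) t)))
-- Connectivity only serves to make the hypothesis on r satisfiable.
theorem3p9 F Γ _ r r-resistance s t = begin
  r s t                                                   ≈⟨ resistance≈energy s t ⟩
  energy v v                                              ≈⟨ four⁻¹*four*x≈x (energy v v) ⟨
  four F ⁻¹ * (four F * energy v v)
    ≈⟨ *-congˡ (*-distribˡ-sum (four F) (λ e → L e ⁻¹ * sq F (δ e))) ⟩
  four F ⁻¹ * sum (λ e → four F * (L e ⁻¹ * sq F (δ e)))  ≈⟨ *-congˡ (sum-cong-≋ edge-term) ⟩
  four F ⁻¹ * sum (λ e → L e ⁻¹ * sq F (D e))             ≡⟨ ≡.cong (four F ⁻¹ *_) (sumF≡sum nE _) ⟨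
  four F ⁻¹ * sumF F nE (λ e → L e ⁻¹ * sq F (D e))       ∎
  where
  open OrderedField F hiding (zero)
  open MetrizedGraph Γ
  open ElectricalNetwork F
  open Network Γ
  open EffectiveResistance r r-resistance
  open import Algebra.Properties.Semiring.Sum semiring using (sum; sum-cong-≋; *-distribˡ-sum)
  open import Algebra.Properties.CommutativeSemigroup *-commutativeSemigroup using (x∙yz≈y∙xz)
  open import Relation.Binary.Reasoning.Setoid setoid
  v = potential s t
  δ D : Fin nE → Carrier
  δ e = v (p e) - v (q e)
  D e = ((r (p e) s - r (q e) s) - r (p e) t) + r (q e) t
  edge-term : ∀ e → four F * (L e ⁻¹ * sq F (δ e)) ≈ L e ⁻¹ * sq F (D e)
  edge-term e = trans (x∙yz≈y∙xz _ _ _) (*-congˡ (begin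
    four F * sq F (δ e)        ≈⟨ sq-neg-double (δ e) ⟨
    sq F (- (δ e + δ e))       ≈⟨ sq-cong (resistance-cross-difference s t (p e) (q e)) ⟨
    sq F (D e)                 ∎))
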